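{- Let $n\ge1$ and let $\lambda$ be a partition with $1\le|\lambda|\le n+1$. For any $\sigma\in\mathcal{OP}_{n,\lambda}$ with exactly one empty box, there exists $\gamma\in\mathcal{OP}_{n,\lambda}$ such that $\gamma$ has exactly one empty box, that box is in row 1, column 1, the entries of the boxes of $\gamma$ are decreasing from left to right in each row (the empty box counted as $\infty$), and $\mathsf{code}(\gamma)_i\le\mathsf{code}(\sigma)_i$ for all $i\in[n]$.
   Context: For a partition $\lambda$ with conjugate $\lambda'$, consider the Young diagram of $\lambda'$ (row $i$, counted from the top, has boxes in columns $1,\dots,\lambda'_i$; column $c$ has $\lambda_c$ boxes in rows $1,\dots,\lambda_c$), columns indexed by all positive integers. A container diagram of $(n,\lambda)$ is a placement of each of $1,\dots,n$ exactly once, either in a box or floating above row 1 in some column, such that each box has at most one number, numbers strictly decrease from top to bottom in each column (floating numbers being above all boxes), and an empty box has no number above it in its column. Equivalently: an ordered sequence $(S_1,S_2,\dots)$ of disjoint sets with union $[n]$, the elements of $S_c$ placed in column $c$ decreasingly from top to bottom with the smallest in row $\lambda_c$, the next in row $\lambda_c-1$, etc., extras floating above and unfilled top boxes empty. $\mathcal{OP}_{n,\lambda}$ is the set of container diagrams. Treating empty boxes as containing $\infty$, $\mathsf{code}(\sigma)$ is the length-$n$ sequence whose $i$-th entry is: if $i$ is in a box in row $r$, column $c$, the number of boxes in row $r$ in columns $>c$ or in row $r+1$ in columns $<c$ containing a number larger than $i$; if $i$ floats in column $c$, $c-1$ plus the number of boxes in row 1 in columns $>c$ containing a number larger than $i$.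 -}

module Defs where

open import Data.Nat using (ℕ; zero; suc; _+_; _∸_; _≤_; _<_; _≤?_; _<?_; _≟_)
open import Data.Fin as F using (Fin)
open import Data.List using (List; []; _∷_; length; filter; map; upTo; allFin)
open import Data.Nat.ListAction using (sum)
open import Data.List.Relation.Unary.All using (All)
open import Data.List.Relation.Unary.Linked using (Linked)
open import Data.Product using (_×_)
open import Data.Empty using (⊥)
open import Relation.Nullary using (yes; no)
open import Relation.Nullary.Decidable using (_×-dec_)
open import Relation.Binary.PropositionalEquality using (_≡_)

IsPartition : List ℕ → Set
IsPartition p = Linked (λ a b → b ≤ a) p × All (λ a → 0 < a) p

size : List ℕ → ℕ
size = sum

-- part p c = λ_{c+1} (columns are 0-based here: column c here = column c+1 of the paper);
-- 0 beyond the length of λ.  Column c of the diagram of λ' has part p c boxes.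
part : List ℕ → ℕ → ℕ
part []       _       = 0
part (x ∷ _)  zero    = x
part (_ ∷ xs) (suc c) = part xs c

-- A container diagram of (n, λ) is an ordered sequence (S₁, S₂, …) of disjoint sets
-- with union [n]; equivalently a map sending each number (Fin n, with 0..n-1 standing
-- for 1..n, order preserved) to its (0-based) column.
OP : ℕ → Set
OP n = Fin n → ℕ

module _ {n : ℕ} (p : List ℕ) (σ : OP n) where

  colSize : ℕ → ℕ
  colSize c = length (filter (λ j → σ j ≟ c) (allFin n))

  rank : Fin n → ℕ
  rank i = length (filter (λ j → (σ j ≟ σ i) ×-dec (j F.<? i)) (allFin n))

  InBox : Fin n → Set
  InBox i = rank i < part p (σ i)

  -- (1-based) row of i when it sits in a box: smallest in row λ_c, next in λ_c - 1, ...
  row : Fin n → ℕ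
  row i = part p (σ i) ∸ rank i

  -- number of empty boxes in column c (they are the top ones)
  emptyIn : ℕ → ℕ
  emptyIn c = part p c ∸ colSize c

  IsEmptyBox : ℕ → ℕ → Set
  IsEmptyBox r c = 1 ≤ r × r ≤ emptyIn c

  -- total number of empty boxes (columns ≥ length λ have no boxes)
  numEmpty : ℕ
  numEmpty = sum (map emptyIn (upTo (length p)))

  -- boxes in row r, columns > c, containing a number larger than i or empty (∞)
  rightBigger : Fin n → ℕ → ℕ → ℕ
  rightBigger i r c =
      length (filter (λ c' → ((1 ≤? r) ×-dec (r ≤? emptyIn c')) ×-dec (c <? c')) (upTo (length p)))
    + length (filter (λ j → (i F.<? j) ×-dec ((rank j <? part p (σ j)) ×-dec ((row j ≟ r) ×-dec (c <? σ j)))) (allFin n))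

  -- boxes in row r, columns < c, containing a number larger than i or empty (∞)
  leftBigger : Fin n → ℕ → ℕ → ℕ
  leftBigger i r c =
      length (filter (λ c' → ((1 ≤? r) ×-dec (r ≤? emptyIn c')) ×-dec (c' <? c)) (upTo (length p)))
    + length (filter (λ j → (i F.<? j) ×-dec ((rank j <? part p (σ j)) ×-dec ((row j ≟ r) ×-dec (σ j <? c)))) (allFin n))

  code : Fin n → ℕ
  code i with rank i <? part p (σ i)
  ... | yes _ = rightBigger i (row i) (σ i) + leftBigger i (suc (row i)) (σ i)
  ... | no  _ = σ i + rightBigger i 1 (σ i)   -- σ i = (paper column) - 1

  RowDecreasing : Set
  RowDecreasing =
      (∀ j j' → InBox j → InBox j' → row j ≡ row j' → σ j < σ j' → j' F.< j)
    × (∀ r c c' → IsEmptyBox r c → c' < c → r ≤ part p c' → ⊥)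

module Submission where

-- γ keeps every boxed number of σ in its row and sorts each row decreasingly from the left,
-- starting row 1 in column 2 so that box (1,1) stays empty; a floating number f floats over the
-- column just right of the row-1 numbers larger than f.  Each row of σ holds no more numbers than
-- the corresponding row of γ has places, so the boxed numbers of σ land in boxes of γ; each column
-- of γ receives at most as many of them as it has boxes (bar box (1,1)); as σ has one empty box
-- the totals agree, so every column of γ is full except for box (1,1), and the rows of γ are the
-- sorted rows of σ.
-- Codes: in γ a boxed i only sees larger numbers of the row below, to its left.  In σ such a j is
-- either below-left of i, or below-right of i, and then the box directly above j holds a number
-- larger than i to the right of i, or is the empty box.  A floating f has code 1 + ℓ in γ, ℓ the
-- number of larger row-1 numbers; in σ each of these lies right of f's column, or left of it but
-- outside the column c₀ of the empty box, and box (1, c₀) is counted on the right if c₀ is.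

open import Defs
open import Data.Nat using (ℕ; zero; suc; _+_; _∸_; _≤_; _<_; z≤n; s≤s; _≟_; _<?_; _≤?_)
open import Data.Nat.Properties
open import Data.Nat.ListAction using (sum)
open import Data.List using (List; []; _∷_; _++_; length; filter; map; applyUpTo; upTo; allFin)
open import Data.List.Properties using (length-++; length-map; length-filter; filter-none; filter-all; filter-some; length-upTo)
open import Data.List.Membership.Propositional using (_∈_; lose)
open import Data.List.Membership.Propositional.Properties
  using (∈-filter⁺; ∈-filter⁻; ∈-map⁻; ∈-upTo⁺; ∈-upTo⁻; ∈-allFin; ∈-applyUpTo⁻
        ; ∈-∃++; ∈-++⁻; ∈-++⁺ˡ; ∈-++⁺ʳ)
open import Data.List.Relation.Unary.Any using (here; there)
open import Data.List.Relation.Unary.All as All using (All; []; _∷_)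
import Data.List.Relation.Unary.All.Properties as All
open import Data.List.Relation.Unary.Unique.Propositional using (Unique)
open import Data.List.Relation.Unary.Unique.Propositional.Properties using (filter⁺; allFin⁺; upTo⁺)
open import Data.List.Relation.Unary.AllPairs using ([]; _∷_)
open import Data.List.Relation.Unary.Linked as Linked using (_∷_)
open import Data.Fin as F using (Fin)
import Data.Fin.Properties as F
open import Relation.Binary using (tri<; tri≈; tri>)
open import Data.Product using (Σ; _×_; _,_; proj₁; proj₂)
open import Data.Sum using (inj₁; inj₂)
open import Data.Empty using (⊥-elim)
open import Relation.Nullary using (¬_; Dec; yes; no)
open import Relation.Nullary.Decidable using (_×-dec_; ¬?)
open import Relation.Unary using (Pred; Decidable)
open import Relation.Unary.Properties using (U?)
open import Level using (0ℓ)
open import Function using (id; _∘_; case_of_)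
open import Relation.Binary using (DecidableEquality)
open import Algebra.Properties.CommutativeSemigroup +-commutativeSemigroup using (interchange)
open import Relation.Binary.PropositionalEquality using (_≡_; _≢_; refl; sym; trans; cong; cong₂; subst; module ≡-Reasoning)

module _ {A : Set} where

  count : {P : Pred A 0ℓ} → Decidable P → List A → ℕ
  count P? xs = length (filter P? xs)

  count-mono : {P Q : Pred A 0ℓ} (P? : Decidable P) (Q? : Decidable Q) (xs : List A)
    → (∀ {x} → x ∈ xs → P x → Q x) → count P? xs ≤ count Q? xs
  count-mono P? Q? []       P⇒Q = z≤n
  count-mono P? Q? (x ∷ xs) P⇒Q with P? x | Q? x
  ... | yes px | yes _  = s≤s (count-mono P? Q? xs (P⇒Q ∘ there))
  ... | yes px | no ¬qx = ⊥-elim (¬qx (P⇒Q (here refl) px))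
  ... | no _   | yes _  = m≤n⇒m≤1+n (count-mono P? Q? xs (P⇒Q ∘ there))
  ... | no _   | no _   = count-mono P? Q? xs (P⇒Q ∘ there)

  count-cong : {P Q : Pred A 0ℓ} (P? : Decidable P) (Q? : Decidable Q) (xs : List A)
    → (∀ {x} → x ∈ xs → P x → Q x) → (∀ {x} → x ∈ xs → Q x → P x) → count P? xs ≡ count Q? xs
  count-cong P? Q? xs P⇒Q Q⇒P = ≤-antisym (count-mono P? Q? xs P⇒Q) (count-mono Q? P? xs Q⇒P)

  count-split : {P Q : Pred A 0ℓ} (P? : Decidable P) (Q? : Decidable Q) (xs : List A)
    → count P? xs ≡ count (λ x → P? x ×-dec Q? x) xs + count (λ x → P? x ×-dec ¬? (Q? x)) xs
  count-split P? Q? []       = refl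
  count-split P? Q? (x ∷ xs) with P? x | Q? x
  ... | yes _ | yes _ = cong suc (count-split P? Q? xs)
  ... | yes _ | no _  = trans (cong suc (count-split P? Q? xs)) (sym (+-suc _ _))
  ... | no _  | yes _ = count-split P? Q? xs
  ... | no _  | no _  = count-split P? Q? xs

  module _ {P : Pred A 0ℓ} (P? : Decidable P) where

    count-none : ∀ xs → (∀ {x} → x ∈ xs → ¬ P x) → count P? xs ≡ 0
    count-none xs ¬P = cong length (filter-none P? (All.tabulate ¬P))

    count-all : ∀ xs → (∀ {x} → x ∈ xs → P x) → count P? xs ≡ length xs
    count-all xs allP = cong length (filter-all P? (All.tabulate allP))

    count-witness : ∀ {xs x} → x ∈ xs → P x → 1 ≤ count P? xs
    count-witness x∈ px = filter-some P? (lose x∈ px)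

  count-strict : {P Q : Pred A 0ℓ} (P? : Decidable P) (Q? : Decidable Q) (xs : List A)
    → (∀ {x} → x ∈ xs → P x → Q x) → ∀ {x} → x ∈ xs → Q x → ¬ P x → count P? xs < count Q? xs
  count-strict {P} {Q} P? Q? xs P⇒Q {x} x∈ qx ¬px = begin-strict
    count P? xs                                     ≡⟨ count-cong P? QP? xs (λ x∈ px → P⇒Q x∈ px , px) (λ _ → proj₂) ⟩
    count QP? xs                                    <⟨ m<m+n _ (count-witness (λ y → Q? y ×-dec ¬? (P? y)) x∈ (qx , ¬px)) ⟩
    count QP? xs + count (λ y → Q? y ×-dec ¬? (P? y)) xs ≡⟨ count-split Q? P? xs ⟨
    count Q? xs                                     ∎
    where
    open ≤-Reasoning
    QP? : Decidable (λ y → Q y × P y)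
    QP? y = Q? y ×-dec P? y

  unique-⊆⇒length≤ : {xs ys : List A} → Unique xs → (∀ {x} → x ∈ xs → x ∈ ys) → length xs ≤ length ys
  unique-⊆⇒length≤ {[]}     _          _  = z≤n
  unique-⊆⇒length≤ {x ∷ xs} (x∉xs ∷ u) ⊆ys with ∈-∃++ (⊆ys (here refl))
  ... | ys₁ , ys₂ , refl = begin
    suc (length xs)                ≤⟨ s≤s (unique-⊆⇒length≤ u ⊆ys₁ys₂) ⟩
    suc (length (ys₁ ++ ys₂))      ≡⟨ cong suc (length-++ ys₁) ⟩
    suc (length ys₁ + length ys₂)  ≡⟨ +-suc (length ys₁) (length ys₂) ⟨
    length ys₁ + suc (length ys₂)  ≡⟨ length-++ ys₁ ⟨
    length (ys₁ ++ x ∷ ys₂)        ∎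
    where
    open ≤-Reasoning
    ⊆ys₁ys₂ : ∀ {y} → y ∈ xs → y ∈ ys₁ ++ ys₂
    ⊆ys₁ys₂ y∈ with ∈-++⁻ ys₁ (⊆ys (there y∈))
    ... | inj₁ y∈ys₁         = ∈-++⁺ˡ y∈ys₁
    ... | inj₂ (here refl)   = ⊥-elim (All.lookup x∉xs y∈ refl)
    ... | inj₂ (there y∈ys₂) = ∈-++⁺ʳ ys₁ y∈ys₂

module _ {A B : Set} where

  unique-map : {xs : List A} (f : A → B) → Unique xs
    → (∀ {x y} → x ∈ xs → y ∈ xs → f x ≡ f y → x ≡ y) → Unique (map f xs)
  unique-map {[]}     f []        inj = []
  unique-map {x ∷ xs} f (x∉ ∷ u) inj =
    All.map⁺ (All.tabulate λ y∈ fx≡fy → All.lookup x∉ y∈ (inj (here refl) (there y∈) fx≡fy))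
    ∷ unique-map f u (λ x∈ y∈ → inj (there x∈) (there y∈))

  count-≤-injection : {P : Pred A 0ℓ} {Q : Pred B 0ℓ} (P? : Decidable P) (Q? : Decidable Q)
    {xs : List A} {ys : List B} → Unique xs → (f : A → B)
    → (∀ {x} → x ∈ xs → P x → f x ∈ ys × Q (f x))
    → (∀ {x y} → x ∈ xs → y ∈ xs → P x → P y → f x ≡ f y → x ≡ y)
    → count P? xs ≤ count Q? ys
  count-≤-injection P? Q? {xs} {ys} u f maps inj =
    subst (_≤ count Q? ys) (length-map f (filter P? xs))
      (unique-⊆⇒length≤ (unique-map f (filter⁺ P? u) injᶠ) ⊆filter)
    where
    injᶠ : ∀ {x y} → x ∈ filter P? xs → y ∈ filter P? xs → f x ≡ f y → x ≡ y
    injᶠ x∈ y∈ = let x∈xs , px = ∈-filter⁻ P? x∈ ; y∈xs , py = ∈-filter⁻ P? y∈ in inj x∈xs y∈xs px py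
    ⊆filter : ∀ {z} → z ∈ map f (filter P? xs) → z ∈ filter Q? ys
    ⊆filter z∈ with ∈-map⁻ f z∈
    ... | x , x∈ , refl = let x∈xs , px = ∈-filter⁻ P? x∈ ; fx∈ , qfx = maps x∈xs px in ∈-filter⁺ Q? fx∈ qfx

module _ {A : Set} where

  sum-map-cong : (f g : A → ℕ) (xs : List A) → (∀ {x} → x ∈ xs → f x ≡ g x) → sum (map f xs) ≡ sum (map g xs)
  sum-map-cong f g []       f≡g = refl
  sum-map-cong f g (x ∷ xs) f≡g = cong₂ _+_ (f≡g (here refl)) (sum-map-cong f g xs (f≡g ∘ there))

  sum-map-mono : (f g : A → ℕ) (xs : List A) → (∀ {x} → x ∈ xs → f x ≤ g x) → sum (map f xs) ≤ sum (map g xs)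
  sum-map-mono f g []       f≤g = z≤n
  sum-map-mono f g (x ∷ xs) f≤g = +-mono-≤ (f≤g (here refl)) (sum-map-mono f g xs (f≤g ∘ there))

  sum-map-+ : (f g : A → ℕ) (xs : List A) → sum (map (λ x → f x + g x) xs) ≡ sum (map f xs) + sum (map g xs)
  sum-map-+ f g []       = refl
  sum-map-+ f g (x ∷ xs) =
    trans (cong (f x + g x +_) (sum-map-+ f g xs)) (interchange (f x) (g x) (sum (map f xs)) (sum (map g xs)))

  sum-map-tight : (f g : A → ℕ) (xs : List A) → (∀ {x} → x ∈ xs → f x ≤ g x)
    → sum (map g xs) ≤ sum (map f xs) → ∀ {x} → x ∈ xs → f x ≡ g x
  sum-map-tight f g (y ∷ ys) f≤g Σg≤Σf (here refl) =
    ≤-antisym (f≤g (here refl))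
      (+-cancelʳ-≤ (sum (map g ys)) (g y) (f y)
        (≤-trans Σg≤Σf (+-monoʳ-≤ (f y) (sum-map-mono f g ys (f≤g ∘ there)))))
  sum-map-tight f g (y ∷ ys) f≤g Σg≤Σf (there x∈) =
    sum-map-tight f g ys (f≤g ∘ there)
      (+-cancelˡ-≤ (g y) _ _ (≤-trans Σg≤Σf (+-monoˡ-≤ _ (f≤g (here refl))))) x∈

  sum-map-zero : (f : A → ℕ) (xs : List A) → (∀ {x} → x ∈ xs → f x ≡ 0) → sum (map f xs) ≡ 0
  sum-map-zero f []       f≡0 = refl
  sum-map-zero f (x ∷ xs) f≡0 = cong₂ _+_ (f≡0 (here refl)) (sum-map-zero f xs (f≡0 ∘ there))

  sum-map-∸ : (f g : A → ℕ) (xs : List A) → (∀ {x} → x ∈ xs → g x ≤ f x)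
    → sum (map (λ x → f x ∸ g x) xs) + sum (map g xs) ≡ sum (map f xs)
  sum-map-∸ f g xs g≤f = trans (sym (sum-map-+ (λ x → f x ∸ g x) g xs))
    (sum-map-cong _ f xs (λ x∈ → m∸n+n≡m (g≤f x∈)))

  sum-map-≡0 : (f : A → ℕ) (xs : List A) → sum (map f xs) ≡ 0 → ∀ {x} → x ∈ xs → f x ≡ 0
  sum-map-≡0 f (y ∷ ys) Σ≡0 (here refl) = m+n≡0⇒m≡0 (f y) Σ≡0
  sum-map-≡0 f (y ∷ ys) Σ≡0 (there x∈)  = sum-map-≡0 f ys (m+n≡0⇒n≡0 (f y) Σ≡0) x∈

  sum-map-≡1 : (f : A → ℕ) (xs : List A) → sum (map f xs) ≡ 1
    → Σ A λ a → a ∈ xs × f a ≡ 1 × (∀ {x} → x ∈ xs → 1 ≤ f x → x ≡ a)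
  sum-map-≡1 f (y ∷ ys) Σ≡1 with f y in fy
  ... | 0 = let a , a∈ , fa , onlyA = sum-map-≡1 f ys Σ≡1 in a , there a∈ , fa , λ
    { (here refl) 1≤fy → ⊥-elim (n≮0 (subst (1 ≤_) fy 1≤fy))
    ; (there x∈)  1≤fx → onlyA x∈ 1≤fx }
  ... | 1 = y , here refl , fy , λ
    { (here refl) _    → refl
    ; (there x∈)  1≤fx → ⊥-elim (n≮0 (subst (1 ≤_) (sum-map-≡0 f ys (suc-injective Σ≡1) x∈) 1≤fx)) }

module _ {A B : Set} (_≟ᴮ_ : DecidableEquality B) where

  count-fibres : {P : Pred A 0ℓ} (P? : Decidable P) (f : A → B) (xs : List A) (bs : List B) → Unique bs
    → (∀ {x} → x ∈ xs → P x → f x ∈ bs)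
    → count P? xs ≡ sum (map (λ b → count (λ x → P? x ×-dec (f x ≟ᴮ b)) xs) bs)
  count-fibres P? f xs []       []          f∈ = count-none P? xs (λ x∈ px → case f∈ x∈ px of λ ())
  count-fibres {P} P? f xs (b ∷ bs) (b∉bs ∷ u) f∈ = begin
    count P? xs
      ≡⟨ count-split P? (λ x → f x ≟ᴮ b) xs ⟩
    count (λ x → P? x ×-dec (f x ≟ᴮ b)) xs + count P≢? xs
      ≡⟨ cong (_ +_) (count-fibres P≢? f xs bs u f∈bs) ⟩
    count (λ x → P? x ×-dec (f x ≟ᴮ b)) xs + sum (map (λ b′ → count (λ x → P≢? x ×-dec (f x ≟ᴮ b′)) xs) bs)
      ≡⟨ cong (_ +_) (sum-map-cong _ _ bs λ b′∈ → count-cong _ _ xs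
           (λ _ ((px , _) , fx≡b′) → px , fx≡b′)
           (λ _ (px , fx≡b′) → (px , λ fx≡b → All.lookup b∉bs b′∈ (trans (sym fx≡b) fx≡b′)) , fx≡b′)) ⟩
    sum (map (λ b′ → count (λ x → P? x ×-dec (f x ≟ᴮ b′)) xs) (b ∷ bs))
      ∎
    where
    open ≡-Reasoning
    P≢? : Decidable (λ x → P x × f x ≢ b)
    P≢? x = P? x ×-dec ¬? (f x ≟ᴮ b)
    f∈bs : ∀ {x} → x ∈ xs → P x × f x ≢ b → f x ∈ bs
    f∈bs x∈ (px , fx≢b) with f∈ x∈ px
    ... | here fx≡b  = ⊥-elim (fx≢b fx≡b)
    ... | there fx∈ = fx∈

count-≤-upTo : {A : Set} {P : Pred A 0ℓ} (P? : Decidable P) {xs : List A} → Unique xs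
  → (f : A → ℕ) (k : ℕ) → (∀ {x} → x ∈ xs → P x → f x < k)
  → (∀ {x y} → x ∈ xs → y ∈ xs → P x → P y → f x ≡ f y → x ≡ y)
  → count P? xs ≤ k
count-≤-upTo P? {xs} u f k f<k inj =
  subst (count P? xs ≤_) (trans (count-all U? (upTo k) _) (length-upTo k))
    (count-≤-injection P? U? u f (λ x∈ px → ∈-upTo⁺ (f<k x∈ px) , _) inj)

count-≤-interval : {A : Set} {P : Pred A 0ℓ} (P? : Decidable P) {xs : List A} → Unique xs
  → (f : A → ℕ) (lo hi : ℕ) → (∀ {x} → x ∈ xs → P x → lo ≤ f x × f x ≤ hi)
  → (∀ {x y} → x ∈ xs → y ∈ xs → P x → P y → f x ≡ f y → x ≡ y)
  → count P? xs ≤ suc hi ∸ lo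
count-≤-interval P? u f lo hi bounds inj =
  count-≤-upTo P? u (λ x → f x ∸ lo) (suc hi ∸ lo)
    (λ x∈ px → let lo≤ , ≤hi = bounds x∈ px in ∸-monoˡ-< (s≤s ≤hi) lo≤)
    (λ x∈ y∈ px py eq → inj x∈ y∈ px py (∸-cancelʳ-≡ (proj₁ (bounds x∈ px)) (proj₁ (bounds y∈ py)) eq))

part-beyond : (p : List ℕ) {c : ℕ} → length p ≤ c → part p c ≡ 0
part-beyond []       _         = refl
part-beyond (x ∷ xs) (s≤s L≤c) = part-beyond xs L≤c

1≤part⇒<length : (p : List ℕ) {c : ℕ} → 1 ≤ part p c → c < length p
1≤part⇒<length p {c} 1≤part with c <? length p
... | yes c<L = c<L
... | no c≮L  = ⊥-elim (n≮0 (subst (1 ≤_) (part-beyond p (≮⇒≥ c≮L)) 1≤part))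

rowLength : List ℕ → ℕ → ℕ
rowLength p r = count (λ c → r ≤? part p c) (upTo (length p))

module _ {p : List ℕ} (isPartition : IsPartition p) where

  part-antitone : {c d : ℕ} → c ≤ d → part p d ≤ part p c
  part-antitone = antitone p isPartition
    where
    antitone : (p : List ℕ) → IsPartition p → {c d : ℕ} → c ≤ d → part p d ≤ part p c
    antitone []           _              _         = z≤n
    antitone (x ∷ xs)     _              {zero} {zero} _ = ≤-refl
    antitone (x ∷ [])     _              {zero} {suc d} _ = z≤n
    antitone (x ∷ y ∷ xs) (y≤x ∷ l , a)  {zero} {suc d} _ =
      ≤-trans (antitone (y ∷ xs) (l , All.tail a) {zero} {d} z≤n) y≤x
    antitone (x ∷ xs)     (l , a)        {suc c} {suc d} (s≤s c≤d) =
      antitone xs (Linked.tail l , All.tail a) c≤d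

  part-positive : {c : ℕ} → c < length p → 1 ≤ part p c
  part-positive = positive p (proj₂ isPartition)
    where
    positive : (p : List ℕ) → All (0 <_) p → {c : ℕ} → c < length p → 1 ≤ part p c
    positive (x ∷ xs) (0<x ∷ _) {zero}  _         = 0<x
    positive (x ∷ xs) (_ ∷ a)   {suc c} (s≤s c<L) = positive xs a c<L

  <rowLength⇒≤part : {r k : ℕ} → k < rowLength p r → r ≤ part p k
  <rowLength⇒≤part {r} {k} k<len with r ≤? part p k
  ... | yes r≤part = r≤part
  ... | no r≰part  = ⊥-elim (<⇒≱ k<len (count-≤-upTo (λ c → r ≤? part p c) (upTo⁺ (length p)) id k
          (λ _ r≤part-c → ≰⇒> λ k≤c → r≰part (≤-trans r≤part-c (part-antitone k≤c))) (λ _ _ _ _ eq → eq)))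

m∸[m∸n]≡n∸[n∸m] : ∀ m n → m ∸ (m ∸ n) ≡ n ∸ (n ∸ m)
m∸[m∸n]≡n∸[n∸m] m n with ≤-total m n
... | inj₁ m≤n = trans (cong (m ∸_) (m≤n⇒m∸n≡0 m≤n)) (sym (m∸[m∸n]≡n m≤n))
... | inj₂ n≤m = trans (m∸[m∸n]≡n n≤m) (cong (n ∸_) (sym (m≤n⇒m∸n≡0 n≤m)))

module Diagram {n : ℕ} (p : List ℕ) (σ : OP n) where

  inBox? : Decidable (InBox p σ)
  inBox? i = rank p σ i <? part p (σ i)

  isEmptyBox? : ∀ r c → Dec (IsEmptyBox p σ r c)
  isEmptyBox? r c = (1 ≤? r) ×-dec (r ≤? emptyIn p σ c)

  emptyBoxesIn : ℕ → {C : Pred ℕ 0ℓ} → Decidable C → ℕ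
  emptyBoxesIn r C? = count (λ c → isEmptyBox? r c ×-dec C? c) (upTo (length p))

  LargerIn : Fin n → ℕ → Pred ℕ 0ℓ → Pred (Fin n) 0ℓ
  LargerIn i r C j = i F.< j × InBox p σ j × row p σ j ≡ r × C (σ j)

  largerIn? : (i : Fin n) (r : ℕ) {C : Pred ℕ 0ℓ} → Decidable C → Decidable (LargerIn i r C)
  largerIn? i r C? j = (i F.<? j) ×-dec (inBox? j ×-dec ((row p σ j ≟ r) ×-dec C? (σ j)))

  largerIn : Fin n → ℕ → {C : Pred ℕ 0ℓ} → Decidable C → ℕ
  largerIn i r C? = count (largerIn? i r C?) (allFin n)

  rank-monotone : {i j : Fin n} → σ j ≡ σ i → j F.< i → rank p σ j < rank p σ i
  rank-monotone {i} {j} σj≡σi j<i =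
    count-strict (λ k → (σ k ≟ σ j) ×-dec (k F.<? j)) (λ k → (σ k ≟ σ i) ×-dec (k F.<? i)) (allFin n)
      (λ _ (σk≡σj , k<j) → trans σk≡σj σj≡σi , F.<-trans k<j j<i)
      (∈-allFin j) (σj≡σi , j<i) (λ (_ , j<j) → F.<-irrefl refl j<j)

  rank<colSize : (i : Fin n) → rank p σ i < colSize p σ (σ i)
  rank<colSize i =
    count-strict (λ k → (σ k ≟ σ i) ×-dec (k F.<? i)) (λ k → σ k ≟ σ i) (allFin n)
      (λ _ → proj₁) (∈-allFin i) refl (λ (_ , i<i) → F.<-irrefl refl i<i)

  rank-reflects-< : {i j : Fin n} → σ j ≡ σ i → rank p σ j < rank p σ i → j F.< i
  rank-reflects-< {i} {j} σj≡σi rj<ri with F.<-cmp j i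
  ... | tri< j<i _ _  = j<i
  ... | tri≈ _ refl _ = ⊥-elim (<-irrefl refl rj<ri)
  ... | tri> _ _ i<j  = ⊥-elim (<-asym rj<ri (rank-monotone (sym σj≡σi) i<j))

  rank-injective : {i j : Fin n} → σ j ≡ σ i → rank p σ j ≡ rank p σ i → j ≡ i
  rank-injective {i} {j} σj≡σi rj≡ri with F.<-cmp j i
  ... | tri< j<i _ _ = ⊥-elim (<-irrefl rj≡ri (rank-monotone σj≡σi j<i))
  ... | tri≈ _ j≡i _ = j≡i
  ... | tri> _ _ i<j = ⊥-elim (<-irrefl (sym rj≡ri) (rank-monotone (sym σj≡σi) i<j))

  rank-surjective : (c k : ℕ) → k < colSize p σ c → Σ (Fin n) λ y → σ y ≡ c × rank p σ y ≡ k
  -- Otherwise rank would map the m numbers of column c injectively into [0, m) ∖ {k}.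
  rank-surjective c k k<m with F.any? (λ y → (σ y ≟ c) ×-dec (rank p σ y ≟ k))
  ... | yes witness = witness
  ... | no none     = ⊥-elim (<-irrefl refl (≤-<-trans m≤ ≢k<m))
    where
    m : ℕ
    m = colSize p σ c
    m≤ : m ≤ count (λ j → ¬? (j ≟ k)) (upTo m)
    m≤ = count-≤-injection (λ y → σ y ≟ c) (λ j → ¬? (j ≟ k)) (allFin⁺ n) (rank p σ)
      (λ {y} _ σy≡c → ∈-upTo⁺ (subst (λ d → rank p σ y < colSize p σ d) σy≡c (rank<colSize y))
                    , λ rank≡k → none (y , σy≡c , rank≡k))
      (λ _ _ σx≡c σy≡c rx≡ry → sym (rank-injective (trans σy≡c (sym σx≡c)) (sym rx≡ry)))
    ≢k<m : count (λ j → ¬? (j ≟ k)) (upTo m) < m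
    ≢k<m = subst (count (λ j → ¬? (j ≟ k)) (upTo m) <_) (trans (count-all U? (upTo m) _) (length-upTo m))
      (count-strict (λ j → ¬? (j ≟ k)) U? (upTo m) _ (∈-upTo⁺ k<m) _ (λ k≢k → k≢k refl))

  emptyIn≤part : (c : ℕ) → emptyIn p σ c ≤ part p c
  emptyIn≤part c = m∸n≤m (part p c) (colSize p σ c)

  row-positive : {i : Fin n} → InBox p σ i → 1 ≤ row p σ i
  row-positive = m<n⇒0<n∸m

  row≤part : (i : Fin n) → row p σ i ≤ part p (σ i)
  row≤part i = m∸n≤m (part p (σ i)) (rank p σ i)

  boxed⇒column<length : {i : Fin n} → InBox p σ i → σ i < length p
  boxed⇒column<length boxed = 1≤part⇒<length p (≤-trans (s≤s z≤n) boxed)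

  box-injective : {x y : Fin n} → InBox p σ x → InBox p σ y → σ x ≡ σ y → row p σ x ≡ row p σ y → x ≡ y
  box-injective {x} {y} boxedx boxedy σx≡σy rx≡ry =
    sym (rank-injective (sym σx≡σy) (∸-cancelˡ-≡ (<⇒≤ boxedy′) (<⇒≤ boxedx)
      (trans (cong (λ c → part p c ∸ rank p σ y) σx≡σy) (sym rx≡ry))))
    where
    boxedy′ : rank p σ y < part p (σ x)
    boxedy′ = subst (λ c → rank p σ y < part p c) (sym σx≡σy) boxedy

  row-reflects-< : {x y : Fin n} → σ x ≡ σ y → row p σ x < row p σ y → y F.< x
  row-reflects-< {x} {y} σx≡σy rx<ry =
    rank-reflects-< (sym σx≡σy)
      (∸-cancelʳ-< (subst (λ c → part p (σ x) ∸ rank p σ x < part p c ∸ rank p σ y) (sym σx≡σy) rx<ry))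

  floating⇒column-full : {f : Fin n} → ¬ InBox p σ f → emptyIn p σ (σ f) ≡ 0
  floating⇒column-full {f} floating = m≤n⇒m∸n≡0 (≤-trans (≮⇒≥ floating) (<⇒≤ (rank<colSize f)))

  boxed<floating : {x f : Fin n} → InBox p σ x → ¬ InBox p σ f → σ x ≡ σ f → x F.< f
  boxed<floating {x} {f} boxed floating σx≡σf =
    rank-reflects-< σx≡σf (<-≤-trans boxed (subst (λ c → part p c ≤ rank p σ f) (sym σx≡σf) (≮⇒≥ floating)))

  -- The number in row r of the column of x, or x itself when that box is empty or missing.
  above : ℕ → Fin n → Fin n
  above r x with F.any? (λ y → (σ y ≟ σ x) ×-dec (rank p σ y ≟ part p (σ x) ∸ r))
  ... | yes (y , _) = y
  ... | no _        = x

  above-spec : (r : ℕ) {x : Fin n} → InBox p σ x → 1 ≤ r → r < row p σ x → emptyIn p σ (σ x) < r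
    → σ (above r x) ≡ σ x × InBox p σ (above r x) × row p σ (above r x) ≡ r × x F.< above r x
  above-spec r {x} boxed 1≤r r<row em<r with F.any? (λ y → (σ y ≟ σ x) ×-dec (rank p σ y ≟ part p (σ x) ∸ r))
  ... | yes (y , σy≡σx , rank≡) = σy≡σx , boxedy , rowy , x<y
    where
    r≤part : r ≤ part p (σ x)
    r≤part = ≤-trans (<⇒≤ r<row) (row≤part x)
    boxedy : InBox p σ y
    boxedy = subst (λ c → rank p σ y < part p c) (sym σy≡σx) (subst (_< part p (σ x)) (sym rank≡) (∸-monoʳ-< 1≤r r≤part))
    rowy : row p σ y ≡ r
    rowy = trans (cong₂ _∸_ (cong (part p) σy≡σx) rank≡) (m∸[m∸n]≡n r≤part)
    x<y : x F.< y
    x<y = row-reflects-< σy≡σx (subst (_< row p σ x) (sym rowy) r<row)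
  ... | no none = ⊥-elim (none (rank-surjective (σ x) (part p (σ x) ∸ r) unfilled))
    where
    unfilled : part p (σ x) ∸ r < colSize p σ (σ x)
    unfilled = ≰⇒> λ size≤ → <⇒≱ em<r
      (subst (_≤ emptyIn p σ (σ x)) (m∸[m∸n]≡n (≤-trans (<⇒≤ r<row) (row≤part x))) (∸-monoʳ-≤ (part p (σ x)) size≤))

  largerIn-below≤ : {C : Pred ℕ 0ℓ} (C? : Decidable C) (i : Fin n) {r s : ℕ} → 1 ≤ r → r < s
    → largerIn i s C? ≤ emptyBoxesIn r C? + largerIn i r C?
  largerIn-below≤ {C} C? i {r} {s} 1≤r r<s = begin
    largerIn i s C?                                     ≡⟨ count-split (largerIn? i s C?) E? (allFin n) ⟩
    count (λ x → largerIn? i s C? x ×-dec E? x) (allFin n) + count (λ x → largerIn? i s C? x ×-dec ¬? (E? x)) (allFin n)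
                                                        ≤⟨ +-mono-≤ belowEmpty belowFilled ⟩
    emptyBoxesIn r C? + largerIn i r C?                 ∎
    where
    open ≤-Reasoning
    E? : Decidable (λ j → IsEmptyBox p σ r (σ j))
    E? j = isEmptyBox? r (σ j)
    sameCell : ∀ {x y} → LargerIn i s C x → LargerIn i s C y → σ x ≡ σ y → x ≡ y
    sameCell (_ , bx , rx , _) (_ , by , ry , _) σx≡σy = box-injective bx by σx≡σy (trans rx (sym ry))
    belowEmpty : count (λ x → largerIn? i s C? x ×-dec E? x) (allFin n) ≤ emptyBoxesIn r C?
    belowEmpty = count-≤-injection _ _ (allFin⁺ n) σ
      (λ _ ((_ , bx , _ , cx) , ex) → ∈-upTo⁺ (boxed⇒column<length bx) , ex , cx)
      (λ _ _ (lx , _) (ly , _) → sameCell lx ly)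
    aboveLarger : ∀ {x} → LargerIn i s C x → ¬ IsEmptyBox p σ r (σ x) → LargerIn i r C (above r x) × σ (above r x) ≡ σ x
    aboveLarger (i<x , bx , rx , cx) ¬ex =
      let σa≡σx , ba , ra , x<a = above-spec r bx 1≤r (subst (r <_) (sym rx) r<s) (≰⇒> λ r≤em → ¬ex (1≤r , r≤em))
      in (F.<-trans i<x x<a , ba , ra , subst C (sym σa≡σx) cx) , σa≡σx
    belowFilled : count (λ x → largerIn? i s C? x ×-dec ¬? (E? x)) (allFin n) ≤ largerIn i r C?
    belowFilled = count-≤-injection _ _ (allFin⁺ n) (above r)
      (λ _ (lx , ¬ex) → ∈-allFin _ , proj₁ (aboveLarger lx ¬ex))
      (λ _ _ (lx , ¬ex) (ly , ¬ey) ax≡ay → sameCell lx ly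
        (trans (sym (proj₂ (aboveLarger lx ¬ex))) (trans (cong σ ax≡ay) (proj₂ (aboveLarger ly ¬ey)))))

  largerIn-antitone : {C : Pred ℕ 0ℓ} (C? : Decidable C) {r : ℕ} {x y : Fin n} → x F.< y
    → InBox p σ y → row p σ y ≡ r → C (σ y) → largerIn y r C? < largerIn x r C?
  largerIn-antitone C? x<y boxed rowy cy =
    count-strict _ _ (allFin n) (λ _ (y<z , rest) → F.<-trans x<y y<z , rest)
      (∈-allFin _) (x<y , boxed , rowy , cy) (λ (y<y , _) → F.<-irrefl refl y<y)

  filledIn : ℕ → ℕ
  filledIn c = count (λ i → inBox? i ×-dec (σ i ≟ c)) (allFin n)

  part∸emptyIn≤filledIn : (c : ℕ) → part p c ∸ emptyIn p σ c ≤ filledIn c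
  part∸emptyIn≤filledIn c = begin
    part p c ∸ (part p c ∸ colSize p σ c) ≡⟨ m∸[m∸n]≡n∸[n∸m] (part p c) (colSize p σ c) ⟩
    colSize p σ c ∸ (colSize p σ c ∸ part p c) ≤⟨ ∸-monoʳ-≤ (colSize p σ c) floating≤ ⟩
    colSize p σ c ∸ floating                   ≡⟨ cong (_∸ floating) (count-split (λ i → σ i ≟ c) inBox? (allFin n)) ⟩
    filled + floating ∸ floating               ≡⟨ m+n∸n≡m filled floating ⟩
    filled                                     ≡⟨ count-cong _ _ (allFin n) (λ _ (σi≡c , boxed) → boxed , σi≡c)
                                                                          (λ _ (boxed , σi≡c) → σi≡c , boxed) ⟩
    filledIn c                                 ∎
    where
    open ≤-Reasoning
    filled floating : ℕ
    filled   = count (λ i → (σ i ≟ c) ×-dec inBox? i) (allFin n)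
    floating = count (λ i → (σ i ≟ c) ×-dec ¬? (inBox? i)) (allFin n)
    floating≤ : floating ≤ colSize p σ c ∸ part p c
    floating≤ = count-≤-upTo _ (allFin⁺ n) (λ i → rank p σ i ∸ part p c) (colSize p σ c ∸ part p c)
      (λ {i} _ (σi≡c , fl) → ∸-monoˡ-< (subst (λ d → rank p σ i < colSize p σ d) σi≡c (rank<colSize i))
                                        (subst (λ d → part p d ≤ rank p σ i) σi≡c (≮⇒≥ fl)))
      (λ {x} {y} _ _ (σx≡c , flx) (σy≡c , fly) eq → sym (rank-injective (trans σy≡c (sym σx≡c))
        (sym (∸-cancelʳ-≡ (subst (λ d → part p d ≤ rank p σ x) σx≡c (≮⇒≥ flx))
                          (subst (λ d → part p d ≤ rank p σ y) σy≡c (≮⇒≥ fly)) eq))))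

  code-boxed : {i : Fin n} → InBox p σ i
    → code p σ i ≡ (emptyBoxesIn (row p σ i) (σ i <?_) + largerIn i (row p σ i) (σ i <?_))
                 + (emptyBoxesIn (suc (row p σ i)) (_<? σ i) + largerIn i (suc (row p σ i)) (_<? σ i))
  code-boxed {i} boxed with inBox? i
  ... | yes _       = refl
  ... | no floating = ⊥-elim (floating boxed)

  code-floating : {i : Fin n} → ¬ InBox p σ i
    → code p σ i ≡ σ i + (emptyBoxesIn 1 (σ i <?_) + largerIn i 1 (σ i <?_))
  code-floating {i} floating with inBox? i
  ... | yes boxed = ⊥-elim (floating boxed)
  ... | no _      = refl

δ₀ : ℕ → ℕ
δ₀ zero    = 1
δ₀ (suc _) = 0

sum-δ₀ : (L : ℕ) → 1 ≤ L → sum (map δ₀ (upTo L)) ≡ 1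
sum-δ₀ (suc L) _ = cong suc (sum-map-zero δ₀ (applyUpTo suc L) λ x∈ → case ∈-applyUpTo⁻ suc x∈ of λ where
  (_ , _ , refl) → refl)

δ₀≤1 : (c : ℕ) → δ₀ c ≤ 1
δ₀≤1 zero    = ≤-refl
δ₀≤1 (suc _) = z≤n

δ₁ : ℕ → ℕ
δ₁ (suc zero) = 1
δ₁ _          = 0

δ₁-≥2 : {r : ℕ} → 2 ≤ r → δ₁ r ≡ 0
δ₁-≥2 (s≤s (s≤s _)) = refl

module SingleEmptyBox {n : ℕ} {p : List ℕ} (isPartition : IsPartition p) (σ : OP n)
  (numEmpty≡1 : numEmpty p σ ≡ 1) (c₀ : ℕ) (empty-c₀ : emptyIn p σ c₀ ≡ 1)
  (onlyEmpty : ∀ {c} → c ∈ upTo (length p) → 1 ≤ emptyIn p σ c → c ≡ c₀) where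

  open Diagram p σ

  emptyColumn : {c : ℕ} → 1 ≤ emptyIn p σ c → c ≡ c₀
  emptyColumn {c} 1≤em = onlyEmpty (∈-upTo⁺ (1≤part⇒<length p (≤-trans 1≤em (emptyIn≤part c)))) 1≤em

  emptyIn≤1 : (c : ℕ) → emptyIn p σ c ≤ 1
  emptyIn≤1 c with 1 ≤? emptyIn p σ c
  ... | yes 1≤em = ≤-reflexive (trans (cong (emptyIn p σ) (emptyColumn 1≤em)) empty-c₀)
  ... | no  1≰em = ≤-trans (≮⇒≥ 1≰em) z≤n

  row≥2-in-c₀ : {x : Fin n} → InBox p σ x → σ x ≡ c₀ → 2 ≤ row p σ x
  row≥2-in-c₀ {x} _ σx≡c₀ = subst (_< row p σ x) em≡1 (∸-monoʳ-< (rank<colSize x) size≤part)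
    where
    em≡1 : emptyIn p σ (σ x) ≡ 1
    em≡1 = trans (cong (emptyIn p σ) σx≡c₀) empty-c₀
    size≤part : colSize p σ (σ x) ≤ part p (σ x)
    size≤part = ≮⇒≥ λ part<size → 0≢1+n (trans (sym (m≤n⇒m∸n≡0 (<⇒≤ part<size))) em≡1)

  floating-column≢c₀ : {f : Fin n} → ¬ InBox p σ f → σ f ≢ c₀
  floating-column≢c₀ floating σf≡c₀ =
    0≢1+n (trans (sym (floating⇒column-full floating)) (trans (cong (emptyIn p σ) σf≡c₀) empty-c₀))

  emptyBoxesIn≤δ₁ : (r : ℕ) {C : Pred ℕ 0ℓ} (C? : Decidable C) → emptyBoxesIn r C? ≤ δ₁ r
  emptyBoxesIn≤δ₁ zero             C? = ≤-reflexive (count-none _ (upTo (length p)) λ _ ((1≤0 , _) , _) → n≮0 1≤0)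
  emptyBoxesIn≤δ₁ (suc zero)       C? = count-≤-upTo _ (upTo⁺ (length p)) (λ _ → 0) 1 (λ _ _ → s≤s z≤n)
    (λ c∈ d∈ ((_ , 1≤emc) , _) ((_ , 1≤emd) , _) _ → trans (onlyEmpty c∈ 1≤emc) (sym (onlyEmpty d∈ 1≤emd)))
  emptyBoxesIn≤δ₁ (suc (suc r))    C? = ≤-reflexive (count-none _ (upTo (length p))
    λ {c} _ ((_ , r+2≤em) , _) → ≤⇒≯ (emptyIn≤1 c) (≤-trans (s≤s (s≤s z≤n)) r+2≤em))

  1≤part-c₀ : 1 ≤ part p c₀
  1≤part-c₀ = subst (_≤ part p c₀) empty-c₀ (emptyIn≤part c₀)

  c₀<length : c₀ < length p
  c₀<length = 1≤part⇒<length p 1≤part-c₀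

  0<length : 0 < length p
  0<length = ≤-trans (s≤s z≤n) c₀<length

  columnsBefore≤ : {c : ℕ} → c ≢ c₀ → suc (count (λ d → ¬? (d ≟ c₀)) (upTo c)) ≤ c + emptyBoxesIn 1 (c <?_)
  columnsBefore≤ {c} c≢c₀ with <-cmp c₀ c
  ... | tri< c₀<c _ _ = ≤-trans
        (subst (count (λ d → ¬? (d ≟ c₀)) (upTo c) <_) (trans (count-all U? (upTo c) _) (length-upTo c))
          (count-strict _ U? (upTo c) _ (∈-upTo⁺ c₀<c) _ (λ c₀≢c₀ → c₀≢c₀ refl)))
        (m≤m+n c _)
  ... | tri≈ _ c₀≡c _ = ⊥-elim (c≢c₀ (sym c₀≡c))
  ... | tri> _ _ c<c₀ = begin
    suc (count (λ d → ¬? (d ≟ c₀)) (upTo c)) ≤⟨ s≤s (≤-trans (length-filter _ (upTo c)) (≤-reflexive (length-upTo c))) ⟩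
    suc c                                    ≡⟨ +-comm 1 c ⟩
    c + 1                                    ≤⟨ +-monoʳ-≤ c (count-witness _ (∈-upTo⁺ c₀<length)
                                                                ((≤-refl , ≤-reflexive (sym empty-c₀)) , c<c₀)) ⟩
    c + emptyBoxesIn 1 (c <?_)               ∎
    where open ≤-Reasoning

  level : Fin n → ℕ
  level i with inBox? i
  ... | yes _ = row p σ i
  ... | no  _ = 1

  level-boxed : {i : Fin n} → InBox p σ i → level i ≡ row p σ i
  level-boxed {i} boxed with inBox? i
  ... | yes _       = refl
  ... | no floating = ⊥-elim (floating boxed)

  level-floating : {i : Fin n} → ¬ InBox p σ i → level i ≡ 1
  level-floating {i} floating with inBox? i
  ... | yes boxed = ⊥-elim (floating boxed)
  ... | no _      = refl

  level-positive : (i : Fin n) → 1 ≤ level i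
  level-positive i with inBox? i
  ... | yes boxed = row-positive boxed
  ... | no _      = ≤-refl

  -- Columns are 0-based, so row 1 starts in column 1 (the paper's column 2).
  -- Opaque only to keep type checking fast.
  opaque
    rowSort : OP n
    rowSort i = δ₁ (level i) + largerIn i (level i) U?

    rowSort-level : (i : Fin n) → rowSort i ≡ δ₁ (level i) + largerIn i (level i) U?
    rowSort-level i = refl

  rowSort-boxed : {i : Fin n} → InBox p σ i → rowSort i ≡ δ₁ (row p σ i) + largerIn i (row p σ i) U?
  rowSort-boxed {i} boxed = trans (rowSort-level i) (cong (λ r → δ₁ r + largerIn i r U?) (level-boxed boxed))

  rowSort-floating : {i : Fin n} → ¬ InBox p σ i → rowSort i ≡ suc (largerIn i 1 U?)
  rowSort-floating {i} floating = trans (rowSort-level i) (cong (λ r → δ₁ r + largerIn i r U?) (level-floating floating))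

  rowSort-decreasing : {x y : Fin n} → x F.< y → InBox p σ y → row p σ y ≡ level x → rowSort y < rowSort x
  rowSort-decreasing {x} {y} x<y boxedy rowy = begin-strict
    rowSort y                                  ≡⟨ rowSort-boxed boxedy ⟩
    δ₁ (row p σ y) + largerIn y (row p σ y) U? ≡⟨ cong (λ r → δ₁ r + largerIn y r U?) rowy ⟩
    δ₁ (level x) + largerIn y (level x) U?     <⟨ +-monoʳ-< (δ₁ (level x)) (largerIn-antitone U? x<y boxedy rowy _) ⟩
    δ₁ (level x) + largerIn x (level x) U?     ≡⟨ rowSort-level x ⟨
    rowSort x                                  ∎
    where open ≤-Reasoning

  rowSort-injectiveOnRows : {x y : Fin n} → InBox p σ x → InBox p σ y → row p σ x ≡ row p σ y
    → rowSort x ≡ rowSort y → x ≡ y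
  rowSort-injectiveOnRows {x} {y} boxedx boxedy rowx≡rowy γx≡γy with F.<-cmp x y
  ... | tri< x<y _ _ = ⊥-elim (<-irrefl (sym γx≡γy) (rowSort-decreasing x<y boxedy (trans (sym rowx≡rowy) (sym (level-boxed boxedx)))))
  ... | tri≈ _ x≡y _ = x≡y
  ... | tri> _ _ y<x = ⊥-elim (<-irrefl γx≡γy (rowSort-decreasing y<x boxedx (trans rowx≡rowy (sym (level-boxed boxedy)))))

  largerIn-deeper≤rowSort : (i : Fin n) {s : ℕ} → level i < s → largerIn i s U? ≤ rowSort i
  largerIn-deeper≤rowSort i level<s =
    ≤-trans (largerIn-below≤ U? i (level-positive i) level<s)
      (≤-trans (+-monoˡ-≤ _ (emptyBoxesIn≤δ₁ (level i) U?)) (≤-reflexive (sym (rowSort-level i))))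

  rowSort-columnDecreasing : {x i : Fin n} → InBox p σ x → level i < row p σ x → rowSort x ≡ rowSort i → x F.< i
  rowSort-columnDecreasing {x} {i} boxedx level<row γx≡γi with F.<-cmp x i
  ... | tri< x<i _ _  = x<i
  ... | tri≈ _ refl _ = ⊥-elim (<-irrefl (level-boxed boxedx) level<row)
  ... | tri> _ _ i<x  = ⊥-elim (<-irrefl γx≡γi (begin-strict
    rowSort x                                  ≡⟨ rowSort-boxed boxedx ⟩
    δ₁ (row p σ x) + largerIn x (row p σ x) U? ≡⟨ cong (_+ largerIn x (row p σ x) U?)
                                                         (δ₁-≥2 (≤-trans (s≤s (level-positive i)) level<row)) ⟩
    largerIn x (row p σ x) U?                  <⟨ largerIn-antitone U? i<x boxedx refl _ ⟩
    largerIn i (row p σ x) U?                  ≤⟨ largerIn-deeper≤rowSort i level<row ⟩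
    rowSort i                                  ∎))
    where open ≤-Reasoning

  boxesInRow : ℕ → ℕ
  boxesInRow r = count (λ x → inBox? x ×-dec (row p σ x ≟ r)) (allFin n)

  -- The box of row 1 in column c₀ is the empty one.
  δ₁+boxesInRow≤rowLength : {r : ℕ} → 1 ≤ r → δ₁ r + boxesInRow r ≤ rowLength p r
  δ₁+boxesInRow≤rowLength {suc zero} _ = begin-strict
    boxesInRow 1                                                  ≤⟨ count-≤-injection _ _ (allFin⁺ n) σ
      (λ _ (boxed , row≡1) → ∈-upTo⁺ (boxed⇒column<length boxed) , ≤-trans (s≤s z≤n) boxed
                           , λ σx≡c₀ → <-irrefl (sym row≡1) (row≥2-in-c₀ boxed σx≡c₀))
      (λ _ _ (bx , rx) (by , ry) σx≡σy → box-injective bx by σx≡σy (trans rx (sym ry))) ⟩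
    count (λ c → (1 ≤? part p c) ×-dec ¬? (c ≟ c₀)) (upTo (length p)) <⟨ count-strict _ _ (upTo (length p)) (λ _ → proj₁)
      (∈-upTo⁺ c₀<length) 1≤part-c₀ (λ (_ , c₀≢c₀) → c₀≢c₀ refl) ⟩
    rowLength p 1                                                 ∎
    where open ≤-Reasoning
  δ₁+boxesInRow≤rowLength {suc (suc r)} _ = count-≤-injection _ _ (allFin⁺ n) σ
    (λ {x} _ (boxed , rowx) → ∈-upTo⁺ (boxed⇒column<length boxed) , subst (_≤ part p (σ x)) rowx (row≤part x))
    (λ _ _ (bx , rx) (by , ry) σx≡σy → box-injective bx by σx≡σy (trans rx (sym ry)))

  row≤part-rowSort : {i : Fin n} → InBox p σ i → row p σ i ≤ part p (rowSort i)
  row≤part-rowSort {i} boxed = <rowLength⇒≤part isPartition (begin-strict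
    rowSort i                                  ≡⟨ rowSort-boxed boxed ⟩
    δ₁ (row p σ i) + largerIn i (row p σ i) U? <⟨ +-monoʳ-< (δ₁ (row p σ i)) larger<boxes ⟩
    δ₁ (row p σ i) + boxesInRow (row p σ i)    ≤⟨ δ₁+boxesInRow≤rowLength (row-positive boxed) ⟩
    rowLength p (row p σ i)                    ∎)
    where
    open ≤-Reasoning
    larger<boxes : largerIn i (row p σ i) U? < boxesInRow (row p σ i)
    larger<boxes = count-strict _ _ (allFin n) (λ _ (_ , bx , rx , _) → bx , rx) (∈-allFin i) (boxed , refl)
      (λ (i<i , _) → F.<-irrefl refl i<i)

  rowSort<length : {i : Fin n} → InBox p σ i → rowSort i < length p
  rowSort<length boxed = 1≤part⇒<length p (≤-trans (row-positive boxed) (row≤part-rowSort boxed))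

  1+δ₀≤row : {i : Fin n} → InBox p σ i → suc (δ₀ (rowSort i)) ≤ row p σ i
  1+δ₀≤row {i} boxed with row p σ i in rowi
  ... | zero        = ⊥-elim (n≮0 (subst (1 ≤_) rowi (row-positive boxed)))
  ... | suc zero    = subst (λ c → suc (δ₀ c) ≤ 1)
                        (sym (trans (rowSort-boxed boxed) (cong (λ r → δ₁ r + largerIn i (row p σ i) U?) rowi))) ≤-refl
  ... | suc (suc _) = s≤s (≤-trans (δ₀≤1 (rowSort i)) (s≤s z≤n))

  columnFill : ℕ → ℕ
  columnFill c = count (λ i → inBox? i ×-dec (rowSort i ≟ c)) (allFin n)

  columnFill≤ : (c : ℕ) → columnFill c ≤ part p c ∸ δ₀ c
  columnFill≤ c = count-≤-interval _ (allFin⁺ n) (row p σ) (suc (δ₀ c)) (part p c)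
    (λ _ (boxed , γi≡c) → subst (λ d → suc (δ₀ d) ≤ _) γi≡c (1+δ₀≤row boxed)
                        , subst (λ d → _ ≤ part p d) γi≡c (row≤part-rowSort boxed))
    (λ _ _ (bx , γx) (by , γy) rx≡ry → rowSort-injectiveOnRows bx by rx≡ry (trans γx (sym γy)))

  columnFill≡ : {c : ℕ} → c ∈ upTo (length p) → columnFill c ≡ part p c ∸ δ₀ c
  columnFill≡ = sum-map-tight columnFill (λ c → part p c ∸ δ₀ c) (upTo (length p)) (λ _ → columnFill≤ _) (begin
    sum (map (λ c → part p c ∸ δ₀ c) cols)         ≡⟨ +-cancelʳ-≡ 1 _ _ (trans Σ[part∸δ₀]+1 (sym Σ[part∸emptyIn]+1)) ⟩
    sum (map (λ c → part p c ∸ emptyIn p σ c) cols) ≤⟨ sum-map-mono _ filledIn cols (λ _ → part∸emptyIn≤filledIn _) ⟩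
    sum (map filledIn cols)                        ≡⟨ count-fibres _≟_ inBox? σ (allFin n) cols (upTo⁺ (length p))
                                                        (λ _ → ∈-upTo⁺ ∘ boxed⇒column<length) ⟨
    count inBox? (allFin n)                        ≡⟨ count-fibres _≟_ inBox? rowSort (allFin n) cols (upTo⁺ (length p))
                                                        (λ _ → ∈-upTo⁺ ∘ rowSort<length) ⟩
    sum (map columnFill cols)                      ∎)
    where
    open ≤-Reasoning
    cols : List ℕ
    cols = upTo (length p)
    δ₀≤part : ∀ {c} → c ∈ cols → δ₀ c ≤ part p c
    δ₀≤part {zero}  c∈ = part-positive isPartition (∈-upTo⁻ c∈)
    δ₀≤part {suc c} _  = z≤n
    Σ[part∸δ₀]+1 : sum (map (λ c → part p c ∸ δ₀ c) cols) + 1 ≡ sum (map (part p) cols)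
    Σ[part∸δ₀]+1 = trans (cong (sum (map (λ c → part p c ∸ δ₀ c) cols) +_) 
                         (sym (sum-δ₀ (length p) 0<length)))
                         (sum-map-∸ (part p) δ₀ cols δ₀≤part)
    Σ[part∸emptyIn]+1 : sum (map (λ c → part p c ∸ emptyIn p σ c) cols) + 1 ≡ sum (map (part p) cols)
    Σ[part∸emptyIn]+1 = trans (cong (sum (map (λ c → part p c ∸ emptyIn p σ c) cols) +_) (sym numEmpty≡1))
                              (sum-map-∸ (part p) (emptyIn p σ) cols (λ {c} _ → emptyIn≤part c))

  boxed<floating-in-rowSort : {i j : Fin n} → InBox p σ i → ¬ InBox p σ j → rowSort j ≡ rowSort i → i F.< j
  boxed<floating-in-rowSort {i} {j} boxedi floatingj γj≡γi with m≤n⇒m<n∨m≡n (row-positive boxedi)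
  ... | inj₁ 1<row = rowSort-columnDecreasing boxedi (subst (_< row p σ i) (sym (level-floating floatingj)) 1<row) (sym γj≡γi)
  ... | inj₂ 1≡row with F.<-cmp i j
  ...   | tri< i<j _ _  = i<j
  ...   | tri≈ _ refl _ = ⊥-elim (floatingj boxedi)
  ...   | tri> _ _ j<i  = ⊥-elim (<-irrefl (sym γj≡γi) (rowSort-decreasing j<i boxedi (trans (sym 1≡row) (sym (level-floating floatingj)))))

  below-in-rowSort-column : {i j : Fin n} → InBox p σ i → rowSort j ≡ rowSort i → j F.< i
    → InBox p σ j × row p σ i < row p σ j
  below-in-rowSort-column {i} {j} boxedi γj≡γi j<i = byCase (inBox? j)
    where
    byCase : Dec (InBox p σ j) → InBox p σ j × row p σ i < row p σ j
    byCase (no floatingj) = ⊥-elim (F.<-asym j<i (boxed<floating-in-rowSort boxedi floatingj γj≡γi))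
    byCase (yes boxedj) with <-cmp (row p σ i) (row p σ j)
    ... | tri< ri<rj _ _ = boxedj , ri<rj
    ... | tri≈ _ ri≡rj _ = ⊥-elim (F.<-irrefl (rowSort-injectiveOnRows boxedj boxedi (sym ri≡rj) γj≡γi) j<i)
    ... | tri> _ _ rj<ri = ⊥-elim (F.<-asym j<i
          (rowSort-columnDecreasing boxedi (subst (_< row p σ i) (sym (level-boxed boxedj)) rj<ri) (sym γj≡γi)))

  rank-rowSort : {i : Fin n} → InBox p σ i → rank p rowSort i ≡ part p (rowSort i) ∸ row p σ i
  rank-rowSort {i} boxedi = ≤-antisym (subst (_≤ part p c ∸ r) (sym rank≡deeper) deeper≤) (begin
    part p c ∸ r                       ≡⟨ cong (part p c ∸_) (m+[n∸m]≡n δ₀≤r) ⟨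
    part p c ∸ (δ₀ c + (r ∸ δ₀ c))     ≡⟨ ∸-+-assoc (part p c) (δ₀ c) (r ∸ δ₀ c) ⟨
    part p c ∸ δ₀ c ∸ (r ∸ δ₀ c)       ≤⟨ ∸-monoʳ-≤ (part p c ∸ δ₀ c) shallower≤ ⟩
    part p c ∸ δ₀ c ∸ shallower        ≡⟨ cong (_∸ shallower) split ⟨
    deeper + shallower ∸ shallower     ≡⟨ m+n∸n≡m deeper shallower ⟩
    deeper                             ≡⟨ rank≡deeper ⟨
    rank p rowSort i                   ∎)
    where
    open ≤-Reasoning
    c r : ℕ
    c = rowSort i
    r = row p σ i
    inColumn? : Decidable (λ j → InBox p σ j × rowSort j ≡ c)
    inColumn? j = inBox? j ×-dec (rowSort j ≟ c)
    deeper shallower : ℕ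
    deeper    = count (λ j → inColumn? j ×-dec (r <? row p σ j)) (allFin n)
    shallower = count (λ j → inColumn? j ×-dec ¬? (r <? row p σ j)) (allFin n)
    rank≡deeper : rank p rowSort i ≡ deeper
    rank≡deeper = count-cong _ _ (allFin n)
      (λ _ (γj≡γi , j<i) → let boxedj , r<rowj = below-in-rowSort-column boxedi γj≡γi j<i in (boxedj , γj≡γi) , r<rowj)
      (λ _ ((boxedj , γj≡γi) , r<rowj) →
        γj≡γi , rowSort-columnDecreasing boxedj (subst (_< _) (sym (level-boxed boxedi)) r<rowj) γj≡γi)
    injective : ∀ {P : Fin n → Set} {x y} → (InBox p σ x × rowSort x ≡ c) × P x → (InBox p σ y × rowSort y ≡ c) × P y
      → row p σ x ≡ row p σ y → x ≡ y
    injective ((bx , γx) , _) ((by , γy) , _) rx≡ry = rowSort-injectiveOnRows bx by rx≡ry (trans γx (sym γy))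
    deeper≤ : deeper ≤ part p c ∸ r
    deeper≤ = count-≤-interval _ (allFin⁺ n) (row p σ) (suc r) (part p c)
      (λ {j} _ ((boxedj , γj≡c) , r<rowj) → r<rowj , subst (λ d → row p σ j ≤ part p d) γj≡c (row≤part-rowSort boxedj))
      (λ _ _ → injective)
    shallower≤ : shallower ≤ r ∸ δ₀ c
    shallower≤ = count-≤-interval _ (allFin⁺ n) (row p σ) (suc (δ₀ c)) r
      (λ {j} _ ((boxedj , γj≡c) , r≮rowj) →
        subst (λ d → suc (δ₀ d) ≤ row p σ j) γj≡c (1+δ₀≤row boxedj) , ≮⇒≥ r≮rowj)
      (λ _ _ → injective)
    δ₀≤r : δ₀ c ≤ r
    δ₀≤r = ≤-trans (n≤1+n (δ₀ c)) (1+δ₀≤row boxedi)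
    split : deeper + shallower ≡ part p c ∸ δ₀ c
    split = trans (sym (count-split inColumn? (λ j → r <? row p σ j) (allFin n))) (columnFill≡ (∈-upTo⁺ (rowSort<length boxedi)))

  boxed-in-rowSort : {i : Fin n} → InBox p σ i → InBox p rowSort i
  boxed-in-rowSort {i} boxed =
    subst (_< part p (rowSort i)) (sym (rank-rowSort boxed)) (∸-monoʳ-< (row-positive boxed) (row≤part-rowSort boxed))

  row-rowSort : {i : Fin n} → InBox p σ i → row p rowSort i ≡ row p σ i
  row-rowSort {i} boxed = trans (cong (part p (rowSort i) ∸_) (rank-rowSort boxed)) (m∸[m∸n]≡n (row≤part-rowSort boxed))

  part≤columnFill : {c : ℕ} → 1 ≤ c → part p c ≤ columnFill c
  part≤columnFill {suc c} _ with suc c <? length p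
  ... | yes c<L = ≤-reflexive (sym (columnFill≡ (∈-upTo⁺ c<L)))
  ... | no  c≮L = subst (_≤ columnFill (suc c)) (sym (part-beyond p (≮⇒≥ c≮L))) z≤n

  floating-in-rowSort : {f : Fin n} → ¬ InBox p σ f → ¬ InBox p rowSort f
  floating-in-rowSort {f} floating boxedγ = <⇒≱ boxedγ (begin
    part p (rowSort f)      ≤⟨ part≤columnFill (subst (1 ≤_) (sym (rowSort-floating floating)) (s≤s z≤n)) ⟩
    columnFill (rowSort f)  ≤⟨ count-mono _ _ (allFin n) (λ _ (boxedj , γj≡γf) →
                                 γj≡γf , boxed<floating-in-rowSort boxedj floating (sym γj≡γf)) ⟩
    rank p rowSort f        ∎)
    where open ≤-Reasoning

  boxed-in-rowSort⁻ : {i : Fin n} → InBox p rowSort i → InBox p σ i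
  boxed-in-rowSort⁻ {i} boxedγ = byCase (inBox? i)
    where
    byCase : Dec (InBox p σ i) → InBox p σ i
    byCase (yes boxed)    = boxed
    byCase (no  floating) = ⊥-elim (floating-in-rowSort floating boxedγ)

  emptyIn-rowSort : (c : ℕ) → emptyIn p rowSort c ≡ δ₀ c
  emptyIn-rowSort zero    = trans (cong (part p 0 ∸_) size≡) (m∸[m∸n]≡n (part-positive isPartition 0<length))
    where
    size≡ : colSize p rowSort 0 ≡ part p 0 ∸ 1
    size≡ = trans (count-cong _ _ (allFin n) boxedIn0 (λ _ → proj₂)) (columnFill≡ (∈-upTo⁺ 0<length))
      where
      boxedIn0 : ∀ {j} → j ∈ allFin n → rowSort j ≡ 0 → InBox p σ j × rowSort j ≡ 0
      boxedIn0 {j} _ γj≡0 = byCase (inBox? j)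
        where
        byCase : Dec (InBox p σ j) → InBox p σ j × rowSort j ≡ 0
        byCase (yes boxed)    = boxed , γj≡0
        byCase (no  floating) = ⊥-elim (0≢1+n (trans (sym γj≡0) (rowSort-floating floating)))
  emptyIn-rowSort (suc c) =
    m≤n⇒m∸n≡0 (≤-trans (part≤columnFill (s≤s z≤n)) (count-mono _ _ (allFin n) (λ _ → proj₂)))

  numEmpty-rowSort : numEmpty p rowSort ≡ 1
  numEmpty-rowSort = trans (sum-map-cong _ δ₀ (upTo (length p)) (λ {c} _ → emptyIn-rowSort c))
                           (sum-δ₀ (length p) 0<length)

  emptyBox-rowSort : IsEmptyBox p rowSort 1 0
  emptyBox-rowSort = ≤-refl , ≤-reflexive (sym (emptyIn-rowSort 0))

  emptyColumn-rowSort : {c : ℕ} → 1 ≤ emptyIn p rowSort c → c ≡ 0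
  emptyColumn-rowSort {zero}  _    = refl
  emptyColumn-rowSort {suc c} 1≤em = ⊥-elim (n≮0 (subst (1 ≤_) (emptyIn-rowSort (suc c)) 1≤em))

  rowSort-reflects-< : {j j′ : Fin n} → InBox p σ j′ → row p σ j′ ≡ level j → rowSort j < rowSort j′ → j′ F.< j
  rowSort-reflects-< {j} {j′} boxedj′ rowj′≡levelj γj<γj′ with F.<-cmp j j′
  ... | tri> _ _ j′<j  = j′<j
  ... | tri≈ _ j≡j′ _ = ⊥-elim (<-irrefl (cong rowSort j≡j′) γj<γj′)
  ... | tri< j<j′ _ _ = ⊥-elim (<-asym γj<γj′ (rowSort-decreasing j<j′ boxedj′ rowj′≡levelj))

  rowDecreasing-rowSort : RowDecreasing p rowSort
  rowDecreasing-rowSort = boxesDecrease , λ r c c′ (1≤r , r≤em) c′<c _ →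
    n≮0 (subst (c′ <_) (emptyColumn-rowSort (≤-trans 1≤r r≤em)) c′<c)
    where
    boxesDecrease : ∀ j j′ → InBox p rowSort j → InBox p rowSort j′ → row p rowSort j ≡ row p rowSort j′
      → rowSort j < rowSort j′ → j′ F.< j
    boxesDecrease j j′ boxedγj boxedγj′ rowj≡rowj′ =
      rowSort-reflects-< boxedj′ (begin
        row p σ j′        ≡⟨ row-rowSort boxedj′ ⟨
        row p rowSort j′  ≡⟨ rowj≡rowj′ ⟨
        row p rowSort j   ≡⟨ row-rowSort boxedj ⟩
        row p σ j         ≡⟨ level-boxed boxedj ⟨
        level j           ∎)
      where
      open ≡-Reasoning
      boxedj : InBox p σ j
      boxedj = boxed-in-rowSort⁻ boxedγj
      boxedj′ : InBox p σ j′
      boxedj′ = boxed-in-rowSort⁻ boxedγj′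

  module Sorted = Diagram p rowSort

  noEmptyRight-rowSort : (r c : ℕ) → Sorted.emptyBoxesIn r (c <?_) ≡ 0
  noEmptyRight-rowSort r c = count-none _ (upTo (length p)) λ _ ((1≤r , r≤em) , c<d) →
    n≮0 (subst (c <_) (emptyColumn-rowSort (≤-trans 1≤r r≤em)) c<d)

  noLargerRight-rowSort : {i : Fin n} {r : ℕ} → r ≡ level i → Sorted.largerIn i r (rowSort i <?_) ≡ 0
  noLargerRight-rowSort {i} r≡level = count-none _ (allFin n) λ _ (i<j , boxedγj , rowj , γi<γj) →
    let boxedj = boxed-in-rowSort⁻ boxedγj in
    <-asym γi<γj (rowSort-decreasing i<j boxedj (trans (sym (row-rowSort boxedj)) (trans rowj r≡level)))

  code-rowSort-boxed : {i : Fin n} → InBox p σ i → code p rowSort i ≤ largerIn i (suc (row p σ i)) U?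
  code-rowSort-boxed {i} boxed = begin
    code p rowSort i
      ≡⟨ Sorted.code-boxed (boxed-in-rowSort boxed) ⟩
    (Sorted.emptyBoxesIn r (c <?_) + Sorted.largerIn i r (c <?_)) + (Sorted.emptyBoxesIn (suc r) (_<? c) + Sorted.largerIn i (suc r) (_<? c))
      ≡⟨ cong₂ _+_ (cong₂ _+_ (noEmptyRight-rowSort r c) (noLargerRight-rowSort (trans (row-rowSort boxed) (sym (level-boxed boxed)))))
                   (cong (_+ Sorted.largerIn i (suc r) (_<? c)) noEmptyBelow) ⟩
    Sorted.largerIn i (suc r) (_<? c)
      ≤⟨ count-mono _ _ (allFin n) (λ _ (i<j , boxedγj , rowj , _) → let boxedj = boxed-in-rowSort⁻ boxedγj in
           i<j , boxedj , trans (sym (row-rowSort boxedj)) (trans rowj (cong suc (row-rowSort boxed))) , _) ⟩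
    largerIn i (suc (row p σ i)) U?
      ∎
    where
    open ≤-Reasoning
    c r : ℕ
    c = rowSort i
    r = row p rowSort i
    noEmptyBelow : Sorted.emptyBoxesIn (suc r) (_<? c) ≡ 0
    noEmptyBelow = count-none _ (upTo (length p)) λ {d} _ ((_ , r+1≤em) , _) →
      <⇒≱ (s≤s (subst (1 ≤_) (sym (row-rowSort boxed)) (row-positive boxed)))
          (≤-trans r+1≤em (≤-trans (≤-reflexive (emptyIn-rowSort d)) (δ₀≤1 d)))

  largerBelow≤code : {i : Fin n} → InBox p σ i → largerIn i (suc (row p σ i)) U? ≤ code p σ i
  largerBelow≤code {i} boxed = begin
    largerIn i (suc r) U?
      ≡⟨ count-split (largerIn? i (suc r) U?) (λ j → σ j <? c) (allFin n) ⟩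
    count (λ j → largerIn? i (suc r) U? j ×-dec (σ j <? c)) (allFin n)
      + count (λ j → largerIn? i (suc r) U? j ×-dec ¬? (σ j <? c)) (allFin n)
      ≤⟨ +-mono-≤ (count-mono _ _ (allFin n) λ _ ((i<j , boxedj , rowj , _) , σj<c) → i<j , boxedj , rowj , σj<c)
                  (count-mono _ _ (allFin n) λ _ ((i<j , boxedj , rowj , _) , σj≮c) → i<j , boxedj , rowj , rightOf i<j rowj σj≮c) ⟩
    largerIn i (suc r) (_<? c) + largerIn i (suc r) (c <?_)
      ≤⟨ +-monoʳ-≤ _ (largerIn-below≤ (c <?_) i (row-positive boxed) ≤-refl) ⟩
    largerIn i (suc r) (_<? c) + (emptyBoxesIn r (c <?_) + largerIn i r (c <?_))
      ≤⟨ +-monoˡ-≤ _ (m≤n+m _ (emptyBoxesIn (suc r) (_<? c))) ⟩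
    (emptyBoxesIn (suc r) (_<? c) + largerIn i (suc r) (_<? c)) + (emptyBoxesIn r (c <?_) + largerIn i r (c <?_))
      ≡⟨ +-comm (emptyBoxesIn (suc r) (_<? c) + largerIn i (suc r) (_<? c)) (emptyBoxesIn r (c <?_) + largerIn i r (c <?_)) ⟩
    (emptyBoxesIn r (c <?_) + largerIn i r (c <?_)) + (emptyBoxesIn (suc r) (_<? c) + largerIn i (suc r) (_<? c))
      ≡⟨ code-boxed boxed ⟨
    code p σ i
      ∎
    where
    open ≤-Reasoning
    c r : ℕ
    c = σ i
    r = row p σ i
    rightOf : ∀ {j} → i F.< j → row p σ j ≡ suc r → ¬ σ j < c → c < σ j
    rightOf i<j rowj σj≮c =
      ≤∧≢⇒< (≮⇒≥ σj≮c) λ c≡σj → F.<-asym i<j (row-reflects-< c≡σj (subst (r <_) (sym rowj) ≤-refl))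

  code-rowSort-floating : {f : Fin n} → ¬ InBox p σ f → code p rowSort f ≤ suc (largerIn f 1 U?)
  code-rowSort-floating {f} floating = ≤-reflexive (begin-equality
    code p rowSort f
      ≡⟨ Sorted.code-floating (floating-in-rowSort floating) ⟩
    rowSort f + (Sorted.emptyBoxesIn 1 (rowSort f <?_) + Sorted.largerIn f 1 (rowSort f <?_))
      ≡⟨ cong₂ _+_ (rowSort-floating floating)
                   (cong₂ _+_ (noEmptyRight-rowSort 1 (rowSort f)) (noLargerRight-rowSort (sym (level-floating floating)))) ⟩
    suc (largerIn f 1 U?) + 0
      ≡⟨ +-identityʳ _ ⟩
    suc (largerIn f 1 U?)
      ∎)
    where open ≤-Reasoning

  largerInRow1<code : {f : Fin n} → ¬ InBox p σ f → suc (largerIn f 1 U?) ≤ code p σ f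
  largerInRow1<code {f} floating = begin
    suc (largerIn f 1 U?)
      ≡⟨ cong suc (count-split (largerIn? f 1 U?) (λ j → c <? σ j) (allFin n)) ⟩
    suc (right + left)
      ≡⟨ +-suc right left ⟨
    right + suc left
      ≤⟨ +-mono-≤ (count-mono _ _ (allFin n) λ _ ((f<j , boxedj , rowj , _) , c<σj) → f<j , boxedj , rowj , c<σj) suc-left≤ ⟩
    largerIn f 1 (c <?_) + (c + emptyBoxesIn 1 (c <?_))
      ≡⟨ +-comm (largerIn f 1 (c <?_)) _ ⟩
    c + emptyBoxesIn 1 (c <?_) + largerIn f 1 (c <?_)
      ≡⟨ +-assoc c _ _ ⟩
    c + (emptyBoxesIn 1 (c <?_) + largerIn f 1 (c <?_))
      ≡⟨ code-floating floating ⟨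
    code p σ f
      ∎
    where
    open ≤-Reasoning
    c : ℕ
    c = σ f
    right left : ℕ
    right = count (λ j → largerIn? f 1 U? j ×-dec (c <? σ j)) (allFin n)
    left  = count (λ j → largerIn? f 1 U? j ×-dec ¬? (c <? σ j)) (allFin n)
    suc-left≤ : suc left ≤ c + emptyBoxesIn 1 (c <?_)
    suc-left≤ = ≤-trans (s≤s (count-≤-injection _ (λ d → ¬? (d ≟ c₀)) (allFin⁺ n) σ
        (λ _ ((f<j , boxedj , rowj , _) , c≮σj) →
          ∈-upTo⁺ (≤∧≢⇒< (≮⇒≥ c≮σj) λ σj≡c → F.<-asym f<j (boxed<floating boxedj floating σj≡c))
          , λ σj≡c₀ → <-irrefl (sym rowj) (row≥2-in-c₀ boxedj σj≡c₀))
        (λ _ _ ((_ , bx , rx , _) , _) ((_ , by , ry , _) , _) σx≡σy → box-injective bx by σx≡σy (trans rx (sym ry)))))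
      (columnsBefore≤ (floating-column≢c₀ floating))

  code-rowSort≤code : (i : Fin n) → code p rowSort i ≤ code p σ i
  code-rowSort≤code i = byCase (inBox? i)
    where
    byCase : Dec (InBox p σ i) → code p rowSort i ≤ code p σ i
    byCase (yes boxed)    = ≤-trans (code-rowSort-boxed boxed) (largerBelow≤code boxed)
    byCase (no  floating) = ≤-trans (code-rowSort-floating floating) (largerInRow1<code floating)

lemmaL : (n : ℕ) → 1 ≤ n → (p : List ℕ) → IsPartition p
  → 1 ≤ size p → size p ≤ suc n
  → (σ : OP n) → numEmpty p σ ≡ 1
  → Σ (OP n) (λ γ → numEmpty p γ ≡ 1 × IsEmptyBox p γ 1 0 × RowDecreasing p γ
      × ((i : Fin n) → code p γ i ≤ code p σ i))
lemmaL n _ p isPartition _ _ σ numEmpty≡1 with sum-map-≡1 (emptyIn p σ) (upTo (length p)) numEmpty≡1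
... | c₀ , _ , empty-c₀ , onlyEmpty =
  rowSort , numEmpty-rowSort , emptyBox-rowSort , rowDecreasing-rowSort , code-rowSort≤code
  where open SingleEmptyBox isPartition σ numEmpty≡1 c₀ empty-c₀ onlyEmpty
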